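{- Let $\Phi=C_n$ or $D_n$ and let ${\bf s}\in\mathbb{Z}^n$. If $|{\bf s}|=(|s_1|,\dots,|s_n|)$ is the score sequence of some Coxeter tournament on the complete $\Phi$-graph, then so is ${\bf s}$.
   Context: Let ${\bf e}_1,\dots,{\bf e}_n$ be the standard basis of $\mathbb{R}^n$, $C_n^+=\{{\bf e}_i\pm{\bf e}_j: i>j\in[n]\}\cup\{2{\bf e}_i:i\in[n]\}$, $D_n^+=\{{\bf e}_i\pm{\bf e}_j: i>j\in[n]\}$. A Coxeter tournament on the complete $\Phi$-graph is an assignment of $w_{\bf e}\in\{0,1\}$ to each ${\bf e}\in\Phi^+$; its score sequence is $\sum_{{\bf e}\in\Phi^+}(w_{\bf e}-1/2){\bf e}$. -}

module Defs where

open import Data.Nat using (ℕ; _<ᵇ_)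
open import Data.Integer using (ℤ; +_; -[1+_]; _+_; _*_; -_)
open import Data.Fin using (Fin; toℕ; _≟_)
open import Data.Bool using (Bool; true; false; if_then_else_)
open import Data.List using (List; []; _∷_; _++_; concatMap; length; foldr; map; lookup; allFin)
open import Relation.Nullary.Decidable using (⌊_⌋)
open import Relation.Binary.PropositionalEquality using (_≡_)
open import Data.Product using (∃)

data RootType : Set where
  C D : RootType

Vecℤ : ℕ → Set
Vecℤ n = Fin n → ℤ

e : ∀ {n} → Fin n → Vecℤ n
e i k = if ⌊ i ≟ k ⌋ then + 1 else + 0

_⊕_ : ∀ {n} → Vecℤ n → Vecℤ n → Vecℤ n
(u ⊕ v) k = u k + v k

_⊖_ : ∀ {n} → Vecℤ n → Vecℤ n → Vecℤ n
(u ⊖ v) k = u k + - v k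

mixedRoots : (n : ℕ) → List (Vecℤ n)
mixedRoots n =
  concatMap (λ i → concatMap (λ j →
      if toℕ j <ᵇ toℕ i then (e i ⊕ e j) ∷ (e i ⊖ e j) ∷ [] else [])
    (allFin n)) (allFin n)

longRoots : (n : ℕ) → List (Vecℤ n)
longRoots n = map (λ i → e i ⊕ e i) (allFin n)

-- Φ⁺ (as a list enumerating the positive roots, each exactly once)
posRoots : RootType → (n : ℕ) → List (Vecℤ n)
posRoots C n = mixedRoots n ++ longRoots n
posRoots D n = mixedRoots n

-- A Coxeter tournament on the complete Φ-graph: a weight w_e ∈ {0,1}
-- for each positive root e (indexed by its position in posRoots).
Tournament : RootType → ℕ → Set
Tournament Φ n = Fin (length (posRoots Φ n)) → Bool

-- 2 (w - 1/2) ∈ {-1, 1}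
sgn : Bool → ℤ
sgn true  = + 1
sgn false = -[1+ 0 ]

sumℤ : List ℤ → ℤ
sumℤ = foldr _+_ (+ 0)

-- twice the score sequence:  2 Σ_e (w_e - 1/2) e  =  Σ_e (2 w_e - 1) e
doubleScore : (Φ : RootType) (n : ℕ) → Tournament Φ n → Vecℤ n
doubleScore Φ n w k =
  sumℤ (map (λ r → sgn (w r) * lookup (posRoots Φ n) r k)
            (allFin (length (posRoots Φ n))))

IsScoreSeq : (Φ : RootType) (n : ℕ) → Vecℤ n → Set
IsScoreSeq Φ n s = ∃ λ (w : Tournament Φ n) → ∀ k → doubleScore Φ n w k ≡ + 2 * s k

-- Let σ flip the coordinates on which s is negative. The map σ sends every positive
-- root of C_n or D_n to ± a positive root: it fixes or negates each 2e_i and each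
-- pair {e_i + e_j, e_i − e_j}, or exchanges the two roots of the pair up to a common
-- sign. Re-orienting the edges of a tournament accordingly therefore produces a
-- tournament whose score sequence is σ applied to the old one, and σ |s| = s.
module Submission where

open import Defs
open import Data.Nat using (ℕ)
open import Data.Integer using (ℤ; +_; -[1+_]; +[1+_]; ∣_∣; _+_; _*_; -_)
import Data.Integer.Properties as ℤ
open import Data.Integer.Tactic.RingSolver using (solve-∀)
open import Data.Fin using (Fin; zero; suc; _≟_)
open import Data.Bool using (Bool; true; false; not; _xor_; if_then_else_)
open import Data.List using (List; []; _∷_; _++_; concatMap; map; length; lookup; tabulate; allFin)
open import Data.List.Properties using (map-tabulate)
open import Data.List.Relation.Unary.All using (All; []; _∷_)
open import Data.List.Relation.Unary.All.Properties using (++⁺; ++⁻; ++↔)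
open import Data.Product using (∃; _×_; _,_; proj₁; proj₂)
open import Data.Sum using (_⊎_; inj₁; inj₂)
open import Function using (Inverse)
open import Relation.Nullary using (yes; no)
open import Relation.Binary.PropositionalEquality
open ≡-Reasoning

module _ {n : ℕ} where

  _·_ : ℤ → Vecℤ n → Vecℤ n
  (c · v) k = c * v k

  Signing : List (Vecℤ n) → Set
  Signing = All (λ _ → Bool)

  score : (L : List (Vecℤ n)) → Signing L → Vecℤ n
  score []      []      k = + 0
  score (v ∷ L) (b ∷ S) k = sgn b * v k + score L S k

  score-++⁺ : ∀ L {M} (S : Signing L) (T : Signing M) →
              score (L ++ M) (++⁺ S T) ≗ score L S ⊕ score M T
  score-++⁺ []      []      T k = sym (ℤ.+-identityˡ _)
  score-++⁺ (v ∷ L) (b ∷ S) T k = begin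
    sgn b * v k + score (L ++ _) (++⁺ S T) k  ≡⟨ cong (λ z → sgn b * v k + z) (score-++⁺ L S T k) ⟩
    sgn b * v k + (score L S k + score _ T k) ≡⟨ ℤ.+-assoc (sgn b * v k) _ _ ⟨
    sgn b * v k + score L S k + score _ T k   ∎

  toSigning : (L : List (Vecℤ n)) → (Fin (length L) → Bool) → Signing L
  toSigning []      w = []
  toSigning (v ∷ L) w = w zero ∷ toSigning L (λ r → w (suc r))

  fromSigning : {L : List (Vecℤ n)} → Signing L → Fin (length L) → Bool
  fromSigning (b ∷ S) zero    = b
  fromSigning (b ∷ S) (suc r) = fromSigning S r

  toSigning-fromSigning : ∀ {L} (S : Signing L) → toSigning L (fromSigning S) ≡ S
  toSigning-fromSigning []      = refl
  toSigning-fromSigning (b ∷ S) = cong (b ∷_) (toSigning-fromSigning S)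

  sum-tabulate≡score : ∀ L (w : Fin (length L) → Bool) k →
    sumℤ (tabulate (λ r → sgn (w r) * lookup L r k)) ≡ score L (toSigning L w) k
  sum-tabulate≡score []      w k = refl
  sum-tabulate≡score (v ∷ L) w k =
    cong (λ z → sgn (w zero) * v k + z) (sum-tabulate≡score L (λ r → w (suc r)) k)

  sgn-* : ∀ b c → sgn b * sgn c ≡ sgn (not (b xor c))
  sgn-* true  true  = refl
  sgn-* true  false = refl
  sgn-* false true  = refl
  sgn-* false false = refl

  sgn-agree-or-oppose : ∀ b c → sgn c ≡ sgn b ⊎ sgn c ≡ - sgn b
  sgn-agree-or-oppose true  true  = inj₁ refl
  sgn-agree-or-oppose true  false = inj₂ refl
  sgn-agree-or-oppose false true  = inj₂ refl
  sgn-agree-or-oppose false false = inj₁ refl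

  module Reflection (τ : Fin n → Bool) where

    reflect : Vecℤ n → Vecℤ n
    reflect v k = sgn (τ k) * v k

    reflect-· : ∀ c v → reflect (c · v) ≗ c · reflect v
    reflect-· c v k = lemma (sgn (τ k)) c (v k)
      where
      lemma : ∀ t c x → t * (c * x) ≡ c * (t * x)
      lemma = solve-∀

    reflect-e : ∀ i → reflect (e i) ≗ sgn (τ i) · e i
    reflect-e i k with i ≟ k
    ... | yes refl = refl
    ... | no  _    = trans (ℤ.*-zeroʳ (sgn (τ k))) (sym (ℤ.*-zeroʳ (sgn (τ i))))

    reflect-e⊕e : ∀ i j → reflect (e i ⊕ e j) ≗ (sgn (τ i) · e i) ⊕ (sgn (τ j) · e j)
    reflect-e⊕e i j k =
      trans (ℤ.*-distribˡ-+ (sgn (τ k)) (e i k) (e j k)) (cong₂ _+_ (reflect-e i k) (reflect-e j k))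

    reflect-e⊖e : ∀ i j → reflect (e i ⊖ e j) ≗ (sgn (τ i) · e i) ⊖ (sgn (τ j) · e j)
    reflect-e⊖e i j k = begin
      sgn (τ k) * (e i k + - e j k)             ≡⟨ ℤ.*-distribˡ-+ (sgn (τ k)) (e i k) (- e j k) ⟩
      sgn (τ k) * e i k + sgn (τ k) * - e j k   ≡⟨ cong (λ z → sgn (τ k) * e i k + z) (ℤ.neg-distribʳ-* (sgn (τ k)) (e j k)) ⟨
      sgn (τ k) * e i k + - (sgn (τ k) * e j k) ≡⟨ cong₂ (λ x y → x + - y) (reflect-e i k) (reflect-e j k) ⟩
      sgn (τ i) * e i k + - (sgn (τ j) * e j k) ∎

    reflect-score-∷ : ∀ v L b (S : Signing L) k →
      reflect (score (v ∷ L) (b ∷ S)) k ≡ sgn b * reflect v k + reflect (score L S) k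
    reflect-score-∷ v L b S k = lemma (sgn (τ k)) (sgn b) (v k) (score L S k)
      where
      lemma : ∀ t x y z → t * (x * y + z) ≡ x * (t * y) + t * z
      lemma = solve-∀

    Closed : List (Vecℤ n) → Set
    Closed L = ∀ (S : Signing L) → ∃ λ (S′ : Signing L) → score L S′ ≗ reflect (score L S)

    closed-[] : Closed []
    closed-[] [] = [] , λ k → sym (ℤ.*-zeroʳ (sgn (τ k)))

    closed-++ : ∀ {L M} → Closed L → Closed M → Closed (L ++ M)
    closed-++ {L} {M} closedL closedM S with ++⁻ L S | Inverse.strictlyInverseˡ (++↔ {xs = L}) S
    ... | S₁ , S₂ | refl with closedL S₁ | closedM S₂
    ... | S₁′ , h₁ | S₂′ , h₂ = ++⁺ S₁′ S₂′ , λ k → begin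
      score (L ++ M) (++⁺ S₁′ S₂′) k                      ≡⟨ score-++⁺ L S₁′ S₂′ k ⟩
      score L S₁′ k + score M S₂′ k                        ≡⟨ cong₂ _+_ (h₁ k) (h₂ k) ⟩
      reflect (score L S₁) k + reflect (score M S₂) k      ≡⟨ ℤ.*-distribˡ-+ (sgn (τ k)) _ _ ⟨
      reflect (score L S₁ ⊕ score M S₂) k                  ≡⟨ cong (sgn (τ k) *_) (score-++⁺ L S₁ S₂ k) ⟨
      reflect (score (L ++ M) (++⁺ S₁ S₂)) k               ∎

    -- A root mapped to ±itself keeps or reverses its orientation.
    closed-∷ : ∀ {v L} c → reflect v ≗ sgn c · v → Closed L → Closed (v ∷ L)
    closed-∷ {v} {L} c hv closedL (b ∷ S) with closedL S
    ... | S′ , h = not (b xor c) ∷ S′ , λ k → begin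
      sgn (not (b xor c)) * v k + score L S′ k      ≡⟨ cong₂ (λ x y → x * v k + y) (sym (sgn-* b c)) (h k) ⟩
      sgn b * sgn c * v k + reflect (score L S) k   ≡⟨ cong (_+ reflect (score L S) k) (ℤ.*-assoc (sgn b) (sgn c) (v k)) ⟩
      sgn b * (sgn c * v k) + reflect (score L S) k ≡⟨ cong (λ z → sgn b * z + reflect (score L S) k) (hv k) ⟨
      sgn b * reflect v k + reflect (score L S) k ≡⟨ reflect-score-∷ v L b S k ⟨
      reflect (score (v ∷ L) (b ∷ S)) k           ∎

    -- Two roots exchanged by the reflection (up to a common sign) exchange orientations.
    closed-swap : ∀ {a b L} c → reflect a ≗ sgn c · b → reflect b ≗ sgn c · a →
                  Closed L → Closed (a ∷ b ∷ L)
    closed-swap {a} {b} {L} c ha hb closedL (x ∷ y ∷ S) with closedL S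
    ... | S′ , h = not (y xor c) ∷ not (x xor c) ∷ S′ , λ k → begin
      sgn (not (y xor c)) * a k + (sgn (not (x xor c)) * b k + score L S′ k)
        ≡⟨ cong₂ (λ p q → p * a k + (q * b k + score L S′ k)) (sgn-* y c) (sgn-* x c) ⟨
      sgn y * sgn c * a k + (sgn x * sgn c * b k + score L S′ k)
        ≡⟨ exchange (sgn x) (sgn y) (sgn c) (a k) (b k) _ ⟩
      sgn x * (sgn c * b k) + (sgn y * (sgn c * a k) + score L S′ k)
        ≡⟨ cong₂ (λ p q → sgn x * p + (sgn y * q + score L S′ k)) (ha k) (hb k) ⟨
      sgn x * reflect a k + (sgn y * reflect b k + score L S′ k)
        ≡⟨ cong (λ z → sgn x * reflect a k + (sgn y * reflect b k + z)) (h k) ⟩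
      sgn x * reflect a k + (sgn y * reflect b k + reflect (score L S) k)
        ≡⟨ cong (λ z → sgn x * reflect a k + z) (reflect-score-∷ b L y S k) ⟨
      sgn x * reflect a k + reflect (score (b ∷ L) (y ∷ S)) k
        ≡⟨ reflect-score-∷ a (b ∷ L) x (y ∷ S) k ⟨
      reflect (score (a ∷ b ∷ L) (x ∷ y ∷ S)) k ∎
      where
      exchange : ∀ x y c A B R → y * c * A + (x * c * B + R) ≡ x * (c * B) + (y * (c * A) + R)
      exchange = solve-∀

    reflect-mixedPair : ∀ i j →
      (reflect (e i ⊕ e j) ≗ sgn (τ i) · (e i ⊕ e j) × reflect (e i ⊖ e j) ≗ sgn (τ i) · (e i ⊖ e j)) ⊎
      (reflect (e i ⊕ e j) ≗ sgn (τ i) · (e i ⊖ e j) × reflect (e i ⊖ e j) ≗ sgn (τ i) · (e i ⊕ e j))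
    reflect-mixedPair i j
      with sgn (τ j) | sgn-agree-or-oppose (τ i) (τ j) | reflect-e⊕e i j | reflect-e⊖e i j
    ... | _ | inj₁ refl | sum | difference =
      inj₁ ( (λ k → trans (sum k) (sym (ℤ.*-distribˡ-+ (sgn (τ i)) (e i k) (e j k))))
           , (λ k → trans (difference k) (agree-difference (sgn (τ i)) (e i k) (e j k))) )
      where
      agree-difference : ∀ u x y → u * x + - (u * y) ≡ u * (x + - y)
      agree-difference = solve-∀
    ... | _ | inj₂ refl | sum | difference =
      inj₂ ( (λ k → trans (sum k) (oppose-sum (sgn (τ i)) (e i k) (e j k)))
           , (λ k → trans (difference k) (oppose-difference (sgn (τ i)) (e i k) (e j k))) )
      where
      oppose-sum : ∀ u x y → u * x + - u * y ≡ u * (x + - y)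
      oppose-sum = solve-∀
      oppose-difference : ∀ u x y → u * x + - (- u * y) ≡ u * (x + y)
      oppose-difference = solve-∀

    closed-mixedPair : ∀ i j → Closed ((e i ⊕ e j) ∷ (e i ⊖ e j) ∷ [])
    closed-mixedPair i j with reflect-mixedPair i j
    ... | inj₁ (fix⊕ , fix⊖)   = closed-∷ (τ i) fix⊕ (closed-∷ (τ i) fix⊖ closed-[])
    ... | inj₂ (swap⊕ , swap⊖) = closed-swap (τ i) swap⊕ swap⊖ closed-[]

    closed-longRoots : Closed (longRoots n)
    closed-longRoots = go (allFin n)
      where
      go : ∀ is → Closed (map (λ i → e i ⊕ e i) is)
      go []       = closed-[]
      go (i ∷ is) = closed-∷ (τ i)
        (λ k → trans (reflect-e⊕e i i k) (sym (ℤ.*-distribˡ-+ (sgn (τ i)) (e i k) (e i k)))) (go is)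

    closed-concatMap : ∀ {A : Set} (f : A → List (Vecℤ n)) → (∀ x → Closed (f x)) →
                       ∀ xs → Closed (concatMap f xs)
    closed-concatMap f closed-f []       = closed-[]
    closed-concatMap f closed-f (x ∷ xs) = closed-++ (closed-f x) (closed-concatMap f closed-f xs)

    closed-if : ∀ c {L M} → Closed L → Closed M → Closed (if c then L else M)
    closed-if true  closedL closedM = closedL
    closed-if false closedL closedM = closedM

    closed-mixedRoots : Closed (mixedRoots n)
    closed-mixedRoots =
      closed-concatMap _ (λ i → closed-concatMap _ (λ j →
        closed-if _ (closed-mixedPair i j) closed-[]) (allFin n)) (allFin n)

    closed-posRoots : ∀ Φ → Closed (posRoots Φ n)
    closed-posRoots C = closed-++ closed-mixedRoots closed-longRoots
    closed-posRoots D = closed-mixedRoots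

doubleScore≗score : ∀ Φ n (w : Tournament Φ n) →
  doubleScore Φ n w ≗ score (posRoots Φ n) (toSigning (posRoots Φ n) w)
doubleScore≗score Φ n w k = begin
  sumℤ (map g (tabulate (λ r → r))) ≡⟨ cong sumℤ (map-tabulate (λ r → r) g) ⟩
  sumℤ (tabulate g)                 ≡⟨ sum-tabulate≡score (posRoots Φ n) w k ⟩
  score (posRoots Φ n) (toSigning (posRoots Φ n) w) k ∎
  where
  g : Fin (length (posRoots Φ n)) → ℤ
  g r = sgn (w r) * lookup (posRoots Φ n) r k

nonNegative : ℤ → Bool
nonNegative (+ _)    = true
nonNegative -[1+ _ ] = false

sgn-nonNegative*∣i∣≡i : ∀ i → sgn (nonNegative i) * + ∣ i ∣ ≡ i
sgn-nonNegative*∣i∣≡i (+ m)    = ℤ.*-identityˡ (+ m)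
sgn-nonNegative*∣i∣≡i -[1+ m ] = ℤ.-1*i≡-i +[1+ m ]

lemma4p3 : (Φ : RootType) (n : ℕ) (s : Vecℤ n) →
    IsScoreSeq Φ n (λ i → + ∣ s i ∣) → IsScoreSeq Φ n s
lemma4p3 Φ n s (w , hw) = fromSigning S′ , λ k → begin
  doubleScore Φ n (fromSigning S′) k       ≡⟨ doubleScore≗score Φ n (fromSigning S′) k ⟩
  score L (toSigning L (fromSigning S′)) k ≡⟨ cong (λ S → score L S k) (toSigning-fromSigning S′) ⟩
  score L S′ k                             ≡⟨ reflected k ⟩
  reflect (score L (toSigning L w)) k      ≡⟨ cong (sgn (nonNegative (s k)) *_) (trans (sym (doubleScore≗score Φ n w k)) (hw k)) ⟩
  reflect ((+ 2) · (λ i → + ∣ s i ∣)) k    ≡⟨ reflect-· (+ 2) (λ i → + ∣ s i ∣) k ⟩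
  + 2 * reflect (λ i → + ∣ s i ∣) k        ≡⟨ cong (+ 2 *_) (sgn-nonNegative*∣i∣≡i (s k)) ⟩
  + 2 * s k                                ∎
  where
  L = posRoots Φ n
  open Reflection (λ k → nonNegative (s k))
  S′ = proj₁ (closed-posRoots Φ (toSigning L w))
  reflected = proj₂ (closed-posRoots Φ (toSigning L w))
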